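{- Let $\beta$ be a positive integer and let $\varphi_1$ be the CFLS coloring on $V=\{0,1\}^{\beta^2}$. There do not exist four distinct vertices $a,b,c,d\in V$ with $\varphi_1(a,b)=\varphi_1(a,c)$, $\varphi_1(b,d)=\varphi_1(b,c)$, and $\varphi_1(a,d)=\varphi_1(c,d)$.
   Context: Let $\beta$ be a positive integer and $V=\{0,1\}^{\beta^2}$. For $v\in V$ write $v=(v^{(1)},\ldots,v^{(\beta)})$ where each block $v^{(i)}\in\{0,1\}^\beta$ consists of consecutive bits of $v$. The CFLS coloring of the edges of the complete graph on $V$ is defined, for distinct $x,y\in V$, by \[\varphi_1(x,y)=\big((i,\{x^{(i)},y^{(i)}\}),\, i_1,\ldots,i_\beta\big),\] where $i$ is the first index with $x^{(i)}\neq y^{(i)}$, and for each $k=1,\ldots,\beta$, $i_k=0$ if $x^{(k)}=y^{(k)}$ and otherwise $i_k$ is the first position at which a bit of $x^{(k)}$ differs from the corresponding bit of $y^{(k)}$. -}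

module Defs where

open import Data.Nat using (ℕ; zero; suc; _*_)
open import Data.Bool using (Bool)
open import Data.Bool.Properties using () renaming (_≟_ to _≟B_)
open import Data.Fin using (Fin; zero; suc; combine)
open import Data.Vec using (Vec; []; _∷_; tabulate; lookup; map)
open import Data.Vec.Properties using (≡-dec)
open import Data.Maybe using (Maybe; just; nothing)
open import Data.Product using (_×_; _,_)
open import Data.Sum using (_⊎_)
open import Relation.Nullary using (yes; no)
open import Relation.Binary.PropositionalEquality using (_≡_)
open import Relation.Binary.Definitions using (DecidableEquality)

Vertex : ℕ → Set
Vertex β = Vec Bool (β * β)

-- Block v^(i) (i = 0,…,β-1, 0-based): the β consecutive bits at positions i*β, …, i*β+β-1.
block : ∀ {β} → Vertex β → Fin β → Vec Bool β
block {β} v i = tabulate (λ j → lookup v (combine i j))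

blocks : ∀ {β} → Vertex β → Vec (Vec Bool β) β
blocks {β} v = tabulate (block v)

firstDiff : ∀ {a} {A : Set a} {n} → DecidableEquality A → Vec A n → Vec A n → Maybe (Fin n)
firstDiff _≟_ [] [] = nothing
firstDiff _≟_ (x ∷ xs) (y ∷ ys) with x ≟ y
... | no _ = just zero
... | yes _ with firstDiff _≟_ xs ys
...   | just i = just (suc i)
...   | nothing = nothing

-- 1-based first differing position, 0 if the vectors are equal
-- (this is i_k of the paper; also used for the index i).
firstDiffℕ : ∀ {a} {A : Set a} {n} → DecidableEquality A → Vec A n → Vec A n → ℕ
firstDiffℕ _≟_ xs ys with firstDiff _≟_ xs ys
... | nothing = 0
... | just i = suc (Data.Fin.toℕ i)

UPairEq : ∀ {a} {A : Set a} → (A × A) → (A × A) → Set a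
UPairEq (p , q) (p' , q') = (p ≡ p' × q ≡ q') ⊎ (p ≡ q' × q ≡ p')

firstPair : ∀ {β} → Vertex β → Vertex β → Maybe (Vec Bool β × Vec Bool β)
firstPair {β} x y with firstDiff (≡-dec _≟B_) (blocks {β} x) (blocks {β} y)
... | nothing = nothing
... | just i = just (block {β} x i , block {β} y i)

-- The CFLS colour φ₁(x,y) = ((i, {x^(i), y^(i)}), i_1, …, i_β).
record Colour (β : ℕ) : Set where
  constructor colour
  field
    index : ℕ                                   -- i (1-based)
    pair  : Maybe (Vec Bool β × Vec Bool β)
    diffs : Vec ℕ β

φ₁ : ∀ {β} → Vertex β → Vertex β → Colour β
φ₁ {β} x y = colour (firstDiffℕ (≡-dec _≟B_) (blocks {β} x) (blocks {β} y))
                    (firstPair x y)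
                    (tabulate (λ k → firstDiffℕ _≟B_ (block {β} x k) (block {β} y k)))

MaybeUPairEq : ∀ {β} → Maybe (Vec Bool β × Vec Bool β) → Maybe (Vec Bool β × Vec Bool β) → Set
MaybeUPairEq nothing nothing = _≡_ 0 0
MaybeUPairEq (just p) (just q) = UPairEq p q
MaybeUPairEq _ _ = _≡_ 0 1

-- Equality of colours (the pair component compared as an unordered pair / 2-element set).
_≡ᶜ_ : ∀ {β} → Colour β → Colour β → Set
colour i p d ≡ᶜ colour i' p' d' = (i ≡ i') × MaybeUPairEq p p' × (d ≡ d')

SameColour : (β : ℕ) → (x y x' y' : Vertex β) → Set
SameColour β x y x' y' = φ₁ {β} x y ≡ᶜ φ₁ {β} x' y'

-- Only the first component of the colour, the first differing block i with the
-- pair {x^(i), y^(i)}, is needed; on sequences of blocks the first difference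
-- behaves like an ultrametric.  If a differs from b and from c first at block i,
-- the pair condition forces b^(i) = c^(i) ≠ a^(i), so b and c agree through
-- block i, and since φ₁(b,d) = φ₁(b,c) so do b and d.  Then a differs from d
-- first at block i as well, while c and d agree through block i, contradicting
-- φ₁(a,d) = φ₁(c,d).
module Submission where

open import Defs
open import Data.Nat using (ℕ; NonZero)
open import Data.Product using (_×_)
open import Relation.Nullary using (¬_)
open import Relation.Binary.PropositionalEquality using (_≢_)

open import Data.Bool using (Bool)
open import Data.Bool.Properties using () renaming (_≟_ to _≟B_)
open import Data.Empty using (⊥; ⊥-elim)
open import Data.Fin as Fin using (Fin; zero; suc; combine; remQuot)
open import Data.Fin.Properties using (combine-remQuot; toℕ-injective; suc-injective; <-irrefl)
open import Data.Maybe as Maybe using (Maybe; just; nothing)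
open import Data.Maybe.Properties using (map-injective)
import Data.Nat as ℕ
open import Data.Product using (_,_; uncurry)
open import Data.Sum using (_⊎_; inj₁; inj₂)
open import Data.Unit using (⊤; tt)
open import Data.Vec using (Vec; []; _∷_; lookup; tabulate)
open import Data.Vec.Properties using (≡-dec; lookup∘tabulate; tabulate∘lookup; tabulate-cong)
open import Relation.Nullary using (yes; no)
open import Relation.Binary.Definitions using (DecidableEquality)
open import Relation.Binary.PropositionalEquality
  using (_≡_; refl; sym; trans; cong; cong₂; subst; subst₂; module ≡-Reasoning)

-- i ≺ firstDiff _≟_ xs ys says that xs and ys agree at all positions ≤ i.
_≺_ : ∀ {n} → Fin n → Maybe (Fin n) → Set
i ≺ nothing = ⊤
i ≺ just k  = i Fin.< k

≺-irrefl : ∀ {n} (i : Fin n) → ¬ i ≺ just i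
≺-irrefl i = <-irrefl refl

zero≺map-suc : ∀ {n} (m : Maybe (Fin n)) → zero ≺ Maybe.map suc m
zero≺map-suc nothing  = tt
zero≺map-suc (just k) = ℕ.s≤s ℕ.z≤n

≺⇒suc≺map-suc : ∀ {n} {i : Fin n} m → i ≺ m → suc i ≺ Maybe.map suc m
≺⇒suc≺map-suc nothing  _   = tt
≺⇒suc≺map-suc (just k) i<k = ℕ.s<s i<k

suc≺map-suc⇒≺ : ∀ {n} {i : Fin n} m → suc i ≺ Maybe.map suc m → i ≺ m
suc≺map-suc⇒≺ nothing  _   = tt
suc≺map-suc⇒≺ (just k) i<k = ℕ.s<s⁻¹ i<k

map-suc≢just-zero : ∀ {n} (m : Maybe (Fin n)) → Maybe.map suc m ≢ just zero
map-suc≢just-zero nothing  ()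
map-suc≢just-zero (just _) ()

map-suc-injective : ∀ {n} {m m′ : Maybe (Fin n)} → Maybe.map suc m ≡ Maybe.map suc m′ → m ≡ m′
map-suc-injective = map-injective suc-injective

module FirstDiff {a} {A : Set a} (_≟_ : DecidableEquality A) where

  firstDiff-∷ : ∀ {n} x y (xs ys : Vec A n) →
                x ≡ y × firstDiff _≟_ (x ∷ xs) (y ∷ ys) ≡ Maybe.map suc (firstDiff _≟_ xs ys)
                ⊎ x ≢ y × firstDiff _≟_ (x ∷ xs) (y ∷ ys) ≡ just zero
  firstDiff-∷ x y xs ys with x ≟ y
  ... | no x≢y = inj₂ (x≢y , refl)
  ... | yes x≡y with firstDiff _≟_ xs ys
  ...   | just _  = inj₁ (x≡y , refl)
  ...   | nothing = inj₁ (x≡y , refl)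

  firstDiff-∷-≡ : ∀ {n x y} {xs ys : Vec A n} → x ≡ y →
                  firstDiff _≟_ (x ∷ xs) (y ∷ ys) ≡ Maybe.map suc (firstDiff _≟_ xs ys)
  firstDiff-∷-≡ {x = x} {y} {xs} {ys} x≡y with firstDiff-∷ x y xs ys
  ... | inj₁ (_ , e)   = e
  ... | inj₂ (x≢y , _) = ⊥-elim (x≢y x≡y)

  firstDiff-∷-≢ : ∀ {n x y} {xs ys : Vec A n} → x ≢ y → firstDiff _≟_ (x ∷ xs) (y ∷ ys) ≡ just zero
  firstDiff-∷-≢ {x = x} {y} {xs} {ys} x≢y with firstDiff-∷ x y xs ys
  ... | inj₁ (x≡y , _) = ⊥-elim (x≢y x≡y)
  ... | inj₂ (_ , e)   = e

  firstDiff-∷-just-zero⁻ : ∀ {n x y} {xs ys : Vec A n} →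
                           firstDiff _≟_ (x ∷ xs) (y ∷ ys) ≡ just zero → x ≢ y
  firstDiff-∷-just-zero⁻ {xs = xs} {ys} e x≡y =
    map-suc≢just-zero (firstDiff _≟_ xs ys) (trans (sym (firstDiff-∷-≡ x≡y)) e)

  firstDiff-∷-just-suc⁻ : ∀ {n x y} {xs ys : Vec A n} {i} →
                          firstDiff _≟_ (x ∷ xs) (y ∷ ys) ≡ just (suc i) →
                          x ≡ y × firstDiff _≟_ xs ys ≡ just i
  firstDiff-∷-just-suc⁻ {x = x} {y} {xs} {ys} e with firstDiff-∷ x y xs ys
  ... | inj₁ (x≡y , e∷) = x≡y , map-suc-injective (trans (sym e∷) e)
  ... | inj₂ (_ , e∷) with () ← trans (sym e∷) e

  ≺-∷⁻ : ∀ {n x y} {xs ys : Vec A n} {i} → i ≺ firstDiff _≟_ (x ∷ xs) (y ∷ ys) → x ≡ y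
  ≺-∷⁻ {x = x} {y} {xs} {ys} {i} h with firstDiff-∷ x y xs ys
  ... | inj₁ (x≡y , _) = x≡y
  ... | inj₂ (_ , e) with () ← subst (i ≺_) e h

  suc≺-∷⁻ : ∀ {n x y} {xs ys : Vec A n} {i} → suc i ≺ firstDiff _≟_ (x ∷ xs) (y ∷ ys) →
            i ≺ firstDiff _≟_ xs ys
  suc≺-∷⁻ {xs = xs} {ys} {i} h =
    suc≺map-suc⇒≺ (firstDiff _≟_ xs ys) (subst (suc i ≺_) (firstDiff-∷-≡ (≺-∷⁻ h)) h)

  firstDiff-nothing⇒≡ : ∀ {n} (xs ys : Vec A n) → firstDiff _≟_ xs ys ≡ nothing → xs ≡ ys
  firstDiff-nothing⇒≡ []       []       _ = refl
  firstDiff-nothing⇒≡ (x ∷ xs) (y ∷ ys) e with firstDiff-∷ x y xs ys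
  ... | inj₁ (x≡y , e∷) = cong₂ _∷_ x≡y (firstDiff-nothing⇒≡ xs ys (map-suc-injective (trans (sym e∷) e)))
  ... | inj₂ (_ , e∷) with () ← trans (sym e∷) e

  firstDiffℕ-injective : ∀ {n} (xs ys xs′ ys′ : Vec A n) →
                         firstDiffℕ _≟_ xs ys ≡ firstDiffℕ _≟_ xs′ ys′ →
                         firstDiff _≟_ xs ys ≡ firstDiff _≟_ xs′ ys′
  firstDiffℕ-injective xs ys xs′ ys′ e with firstDiff _≟_ xs ys | firstDiff _≟_ xs′ ys′
  ... | nothing | nothing = refl
  ... | just _  | just _  = cong just (toℕ-injective (cong ℕ.pred e))

  ≺-firstDiff⇒lookup-≡ : ∀ {n} (xs ys : Vec A n) {i} → i ≺ firstDiff _≟_ xs ys → lookup xs i ≡ lookup ys i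
  ≺-firstDiff⇒lookup-≡ (x ∷ xs) (y ∷ ys) {zero}  h = ≺-∷⁻ h
  ≺-firstDiff⇒lookup-≡ (x ∷ xs) (y ∷ ys) {suc i} h = ≺-firstDiff⇒lookup-≡ xs ys (suc≺-∷⁻ h)

  firstDiff-just-≺ : ∀ {n} (xs ys zs : Vec A n) {i} →
                     firstDiff _≟_ xs ys ≡ just i → firstDiff _≟_ xs zs ≡ just i →
                     lookup ys i ≡ lookup zs i → i ≺ firstDiff _≟_ ys zs
  firstDiff-just-≺ (x ∷ xs) (y ∷ ys) (z ∷ zs) {zero} _ _ y≡z =
    subst (zero ≺_) (sym (firstDiff-∷-≡ y≡z)) (zero≺map-suc (firstDiff _≟_ ys zs))
  firstDiff-just-≺ (x ∷ xs) (y ∷ ys) (z ∷ zs) {suc i} exy exz l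
    with x≡y , exys ← firstDiff-∷-just-suc⁻ exy
       | x≡z , exzs ← firstDiff-∷-just-suc⁻ exz =
    subst (suc i ≺_) (sym (firstDiff-∷-≡ (trans (sym x≡y) x≡z)))
      (≺⇒suc≺map-suc (firstDiff _≟_ ys zs) (firstDiff-just-≺ xs ys zs exys exzs l))

  ≺-firstDiff-just : ∀ {n} (xs ys zs : Vec A n) {i} → i ≺ firstDiff _≟_ ys zs →
                     firstDiff _≟_ xs ys ≡ just i → firstDiff _≟_ xs zs ≡ just i
  ≺-firstDiff-just (x ∷ xs) (y ∷ ys) (z ∷ zs) {zero} h exy =
    firstDiff-∷-≢ (λ x≡z → firstDiff-∷-just-zero⁻ exy (trans x≡z (sym (≺-∷⁻ h))))
  ≺-firstDiff-just (x ∷ xs) (y ∷ ys) (z ∷ zs) {suc i} h exy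
    with x≡y , exys ← firstDiff-∷-just-suc⁻ exy =
    trans (firstDiff-∷-≡ (trans x≡y (≺-∷⁻ h)))
          (cong (Maybe.map suc) (≺-firstDiff-just xs ys zs (suc≺-∷⁻ h) exys))

  firstDiff-no-triangle : ∀ {n} (as bs cs ds : Vec A n) {i} →
                          firstDiff _≟_ as bs ≡ just i → firstDiff _≟_ as cs ≡ just i →
                          lookup bs i ≡ lookup cs i →
                          firstDiff _≟_ bs ds ≡ firstDiff _≟_ bs cs →
                          firstDiff _≟_ as ds ≡ firstDiff _≟_ cs ds → ⊥
  firstDiff-no-triangle as bs cs ds {i} eab eac bᵢ≡cᵢ bd≡bc ad≡cd = ≺-irrefl i i≺cd
    where
    i≺bd : i ≺ firstDiff _≟_ bs ds
    i≺bd = subst (i ≺_) (sym bd≡bc) (firstDiff-just-≺ as bs cs eab eac bᵢ≡cᵢ)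

    ead : firstDiff _≟_ as ds ≡ just i
    ead = ≺-firstDiff-just as bs ds i≺bd eab

    cᵢ≡dᵢ : lookup cs i ≡ lookup ds i
    cᵢ≡dᵢ = trans (sym bᵢ≡cᵢ) (≺-firstDiff⇒lookup-≡ bs ds i≺bd)

    i≺cd : i ≺ just i
    i≺cd = subst (i ≺_) (trans (sym ad≡cd) ead) (firstDiff-just-≺ as cs ds eac ead cᵢ≡dᵢ)

module _ {β : ℕ} where

  private
    _≟ᵇ_ : DecidableEquality (Vec Bool β)
    _≟ᵇ_ = ≡-dec _≟B_

  open FirstDiff _≟ᵇ_

  lookup-blocks : (x : Vertex β) (q r : Fin β) → lookup (lookup (blocks x) q) r ≡ lookup x (combine q r)
  lookup-blocks x q r = begin
    lookup (lookup (blocks x) q) r ≡⟨ cong (λ v → lookup v r) (lookup∘tabulate (block x) q) ⟩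
    lookup (block x q) r           ≡⟨ lookup∘tabulate (λ j → lookup x (combine q j)) r ⟩
    lookup x (combine q r)         ∎
    where open ≡-Reasoning

  blocks-injective : {x y : Vertex β} → blocks x ≡ blocks y → x ≡ y
  blocks-injective {x} {y} eq = begin
    x                   ≡⟨ tabulate∘lookup x ⟨
    tabulate (lookup x) ≡⟨ tabulate-cong lookup-≡ ⟩
    tabulate (lookup y) ≡⟨ tabulate∘lookup y ⟩
    y                   ∎
    where
    open ≡-Reasoning
    lookup-combine-≡ : ∀ q r → lookup x (combine q r) ≡ lookup y (combine q r)
    lookup-combine-≡ q r = trans (sym (lookup-blocks x q r))
      (trans (cong (λ v → lookup (lookup v q) r) eq) (lookup-blocks y q r))
    lookup-≡ : ∀ k → lookup x k ≡ lookup y k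
    lookup-≡ k = subst (λ k → lookup x k ≡ lookup y k) (combine-remQuot {β} β k)
                       (uncurry lookup-combine-≡ (remQuot β k))

  firstPair-just : (x y : Vertex β) {i : Fin β} → firstDiff _≟ᵇ_ (blocks x) (blocks y) ≡ just i →
                   firstPair x y ≡ just (block x i , block y i)
  firstPair-just x y e rewrite e = refl

  samePair⇒sameBlock : (a b c : Vertex β) {i : Fin β} →
                       firstDiff _≟ᵇ_ (blocks a) (blocks b) ≡ just i →
                       firstDiff _≟ᵇ_ (blocks a) (blocks c) ≡ just i →
                       MaybeUPairEq (firstPair a b) (firstPair a c) →
                       lookup (blocks b) i ≡ lookup (blocks c) i
  samePair⇒sameBlock a b c {i} eab eac p = begin
    lookup (blocks b) i ≡⟨ lookup∘tabulate (block b) i ⟩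
    block b i           ≡⟨ bᵢ≡cᵢ (subst₂ MaybeUPairEq (firstPair-just a b eab) (firstPair-just a c eac) p) ⟩
    block c i           ≡⟨ lookup∘tabulate (block c) i ⟨
    lookup (blocks c) i ∎
    where
    open ≡-Reasoning
    bᵢ≡cᵢ : UPairEq (block a i , block b i) (block a i , block c i) → block b i ≡ block c i
    bᵢ≡cᵢ (inj₁ (_ , bᵢ≡cᵢ))      = bᵢ≡cᵢ
    bᵢ≡cᵢ (inj₂ (aᵢ≡cᵢ , bᵢ≡aᵢ)) = trans bᵢ≡aᵢ aᵢ≡cᵢ

  colourTriangle⇒≡ : {a b c d : Vertex β} →
                     SameColour β a b a c → SameColour β b d b c → SameColour β a d c d → a ≡ b
  colourTriangle⇒≡ {a} {b} {c} {d} (ab~ac , pab~pac , _) (bd~bc , _ , _) (ad~cd , _ , _) =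
    byFirstDiff (firstDiff _≟ᵇ_ (blocks a) (blocks b)) refl
    where
    byFirstDiff : ∀ m → firstDiff _≟ᵇ_ (blocks a) (blocks b) ≡ m → a ≡ b
    byFirstDiff nothing  eab = blocks-injective (firstDiff-nothing⇒≡ _ _ eab)
    byFirstDiff (just i) eab = ⊥-elim (firstDiff-no-triangle (blocks a) (blocks b) (blocks c) (blocks d)
      eab eac (samePair⇒sameBlock a b c eab eac pab~pac)
      (firstDiffℕ-injective (blocks b) (blocks d) (blocks b) (blocks c) bd~bc)
      (firstDiffℕ-injective (blocks a) (blocks d) (blocks c) (blocks d) ad~cd))
      where
      eac : firstDiff _≟ᵇ_ (blocks a) (blocks c) ≡ just i
      eac = trans (sym (firstDiffℕ-injective (blocks a) (blocks b) (blocks a) (blocks c) ab~ac)) eab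

mainTheorem4 : (β : ℕ) → .{{_ : NonZero β}} → (a b c d : Vertex β) →
    a ≢ b → a ≢ c → a ≢ d → b ≢ c → b ≢ d → c ≢ d →
    ¬ (SameColour β a b a c × SameColour β b d b c × SameColour β a d c d)
mainTheorem4 β a b c d a≢b _ _ _ _ _ (ab~ac , bd~bc , ad~cd) = a≢b (colourTriangle⇒≡ ab~ac bd~bc ad~cd)
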